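{- There is a constant $C>0$ such that for every $n\ge 1$ and $N=2^n$, there is a 2D SLP with at most $C n$ nonterminals deriving $\mathsf{ShiftBin}_N$.
   Context: Alphabet $\{0,1,\$\}$. A 2D SLP consists of nonterminals, a starting nonterminal, and for each nonterminal one production whose right-hand side is a character, a horizontal concatenation of two nonterminals deriving strings of equal height, or a vertical concatenation of two nonterminals deriving strings of equal width, with acyclic dependency; it derives the string of its starting nonterminal. For $N=2^n$, $\mathsf{Bin}_N$ is the $N\times(n+2)$ 2D string whose $i$-th row ($i\in[1..N]$) is $\$$, followed by the $n$-bit binary representation of $i-1$ (most significant bit first), followed by $\$$. $\mathsf{ShiftBin}_N$ is the $2N\times N(n+2)$ 2D string such that for every $j\in[0..N-1]$, the substring in rows $j+1,\dots,j+N$ and columns $j(n+2)+1,\dots,(j+1)(n+2)$ equals $\mathsf{Bin}_N$, and all other entries are $0$ (i.e., the $j$-th column block is a copy of $\mathsf{Bin}_N$ shifted down by $j$ rows). -}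

module Defs where

open import Data.Nat using (ℕ; zero; suc; _+_; _*_; _∸_; _^_; _≤_; _<_; _<ᵇ_; _≡ᵇ_)
open import Data.Nat.DivMod using (_/_; _%_)
open import Data.Nat.Properties using (m^n≢0)
open import Data.Fin using (Fin; toℕ; splitAt)
open import Data.Bool using (Bool; true; false; if_then_else_; _∧_; _∨_; not)
open import Data.Sum using ([_,_]′)
open import Relation.Binary.PropositionalEquality using (_≡_)

data Sym : Set where
  s0 s1 dollar : Sym

-- A 2D string of height h (rows) and width w (columns); entry (row i, column j), 0-indexed.
Grid : ℕ → ℕ → Set
Grid h w = Fin h → Fin w → Sym

hcat : ∀ {h w₁ w₂} → Grid h w₁ → Grid h w₂ → Grid h (w₁ + w₂)
hcat {w₁ = w₁} A B i j = [ A i , B i ]′ (splitAt w₁ j)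

vcat : ∀ {h₁ h₂ w} → Grid h₁ w → Grid h₂ w → Grid (h₁ + h₂) w
vcat {h₁ = h₁} A B i j = [ (λ i′ → A i′ j) , (λ i′ → B i′ j) ]′ (splitAt h₁ i)

data Rule (m : ℕ) : Set where
  chr : Sym → Rule m
  hor : Fin m → Fin m → Rule m
  ver : Fin m → Fin m → Rule m

-- "every nonterminal on the right-hand side comes strictly before X":
-- acyclicity of the dependency relation, expressed via a topological order of the nonterminals
RefsBelow : ∀ {m} → Fin m → Rule m → Set
RefsBelow X (chr _) = Data.Unit.⊤ where import Data.Unit
RefsBelow X (hor Y Z) = toℕ Y < toℕ X × toℕ Z < toℕ X where open import Data.Product using (_×_)
RefsBelow X (ver Y Z) = toℕ Y < toℕ X × toℕ Z < toℕ X where open import Data.Product using (_×_)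

record SLP2 (m : ℕ) : Set where
  field
    rule    : Fin m → Rule m
    acyclic : ∀ X → RefsBelow X (rule X)
    start   : Fin m

data Derives {m : ℕ} (G : SLP2 m) : Fin m → (h w : ℕ) → Grid h w → Set where
  dchr : ∀ {X a} → SLP2.rule G X ≡ chr a → Derives G X 1 1 (λ _ _ → a)
  dhor : ∀ {X Y Z h w₁ w₂ A B} → SLP2.rule G X ≡ hor Y Z →
         Derives G Y h w₁ A → Derives G Z h w₂ B → Derives G X h (w₁ + w₂) (hcat A B)
  dver : ∀ {X Y Z h₁ h₂ w A B} → SLP2.rule G X ≡ ver Y Z →
         Derives G Y h₁ w A → Derives G Z h₂ w B → Derives G X (h₁ + h₂) w (vcat A B)

DerivesGrid : ∀ {m} → SLP2 m → (h w : ℕ) → Grid h w → Set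
DerivesGrid G h w M =
  Σ (Grid h w) λ M′ → Derives G (SLP2.start G) h w M′ × (∀ i j → M′ i j ≡ M i j)
  where open import Data.Product using (Σ; _×_)

bitSym : ℕ → Sym
bitSym b = if b ≡ᵇ 0 then s0 else s1

-- Bin_N for N = 2^n, at 0-indexed (row r, column c):
-- column 0 and column n+1 are $, column c ∈ [1..n] is bit (n - c) of r (MSB first).
binAt : ℕ → ℕ → ℕ → Sym
binAt n r c =
  if (c ≡ᵇ 0) ∨ (c ≡ᵇ suc n) then dollar else bitSym (((r / (2 ^ (n ∸ c))) {{m^n≢0 2 (n ∸ c)}}) % 2)

Bin : (n : ℕ) → Grid (2 ^ n) (n + 2)
Bin n i j = binAt n (toℕ i) (toℕ j)

-- ShiftBin_N, N = 2^n, size 2N × N(n+2): column block b (columns b(n+2) .. (b+1)(n+2)-1, 0-indexed)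
-- holds Bin_N in rows b .. b+N-1 (0-indexed); all other entries are 0.
shiftBinAt : ℕ → ℕ → ℕ → Sym
shiftBinAt n i j =
  let b = j / suc (suc n)
      c = j % suc (suc n)
  in if not (i <ᵇ b) ∧ (i <ᵇ b + 2 ^ n) then binAt n (i ∸ b) c else s0

ShiftBin : (n : ℕ) → Grid (2 * 2 ^ n) (2 ^ n * (n + 2))
ShiftBin n i j = shiftBinAt n (toℕ i) (toℕ j)

{-# OPTIONS --safe #-}
-- Bin for 2^(k+1) rows is two copies of the bit table B_k of Bin for 2^k rows, one prefixed by a
-- column of 0s and stacked on the other prefixed by a column of 1s; with doubling columns of 0s, 1s
-- and $ this gives B_1, …, B_n, hence Bin_N, with O(1) nonterminals per k. Let Q_j be the first 2^j
-- column blocks of ShiftBin_N (rows 0 … N + 2^j − 1) and Z_j the zero block of the same width and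
-- height 2^j. Then Q_0 is Bin_N above a zero row, and Q_{j+1} = [Q_j / Z_j] | [Z_j / Q_j], because
-- blocks 2^j … 2^(j+1) − 1 are blocks 0 … 2^j − 1 shifted down by 2^j rows. Each Z_{j+1} is four
-- copies of Z_j, so Q_n = ShiftBin_N also costs O(1) nonterminals per j: 14 for each of 2n + 2 levels.

module Submission where

open import Defs
open import Data.Nat using (ℕ; zero; suc; pred; _*_; _^_; _≤_; _<_; _+_; _∸_; s≤s; z<s; _<ᵇ_; NonZero)
open import Data.Nat.Properties
open import Data.Nat.DivMod
open import Data.Nat.Divisibility using (n∣m*n; m∣m*n)
open import Data.Fin using (Fin; toℕ; fromℕ<; splitAt; #_)
open import Data.Fin.Properties using (toℕ-fromℕ<; toℕ<n; toℕ-↑ˡ; toℕ-↑ʳ; splitAt⁻¹-↑ˡ; splitAt⁻¹-↑ʳ)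
open import Data.Product using (Σ; _×_; _,_)
open import Data.Sum using (inj₁; inj₂)
open import Data.Bool using (true; false; if_then_else_; not; _∧_; T)
open import Data.Unit using (⊤; tt)
open import Function using (_∘_)
open import Relation.Nullary using (yes; no; contradiction)
open import Relation.Nullary.Decidable using (dec-true; dec-false)
open import Relation.Binary.PropositionalEquality
open import Data.Nat.Solver using (module +-*-Solver)
open +-*-Solver using (solve; _:+_; _:*_; _:=_; con)

m+m≡2*m : ∀ m → m + m ≡ 2 * m
m+m≡2*m m = cong (m +_) (sym (+-identityʳ m))

[m*n+o]/n≡m+o/n : ∀ m n o .{{_ : NonZero n}} → (m * n + o) / n ≡ m + o / n
[m*n+o]/n≡m+o/n m n o = trans (+-distrib-/-∣ˡ o (n∣m*n m)) (cong (_+ o / n) (m*n/n≡m m n))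

[m*n+o]%n≡o%n : ∀ m n o .{{_ : NonZero n}} → (m * n + o) % n ≡ o % n
[m*n+o]%n≡o%n m n o = trans (cong (_% n) (+-comm (m * n) o)) ([m+kn]%n≡m%n o m n)

[m*c+i]/c≡m : ∀ {c} .{{_ : NonZero c}} m (i : Fin c) → (m * c + toℕ i) / c ≡ m
[m*c+i]/c≡m {c} m i = trans ([m*n+o]/n≡m+o/n m c (toℕ i)) (trans (cong (m +_) (m<n⇒m/n≡0 (toℕ<n i))) (+-identityʳ m))

[m*c+i]%c≡i : ∀ {c} .{{_ : NonZero c}} m (i : Fin c) → (m * c + toℕ i) % c ≡ toℕ i
[m*c+i]%c≡i {c} m i = trans ([m*n+o]%n≡o%n m c (toℕ i)) (m<n⇒m%n≡m (toℕ<n i))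

[m*c+i]<[1+m]*c : ∀ {c} m (i : Fin c) → m * c + toℕ i < suc m * c
[m*c+i]<[1+m]*c {c} m i = subst (m * c + toℕ i <_) (+-comm (m * c) c) (+-monoʳ-< (m * c) (toℕ<n i))

[m*c+i]<[n*c+j] : ∀ {c m n} (i j : Fin c) → m < n → m * c + toℕ i < n * c + toℕ j
[m*c+i]<[n*c+j] {c} {m} {n} i j m<n = begin-strict
  m * c + toℕ i   <⟨ [m*c+i]<[1+m]*c m i ⟩
  suc m * c       ≤⟨ *-monoˡ-≤ c m<n ⟩
  n * c           ≤⟨ m≤m+n (n * c) (toℕ j) ⟩
  n * c + toℕ j   ∎
  where open ≤-Reasoning

module _ (e : ℕ) where
  private instance
    2^e-nonZero : NonZero (2 ^ e)
    2^e-nonZero = m^n≢0 2 e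

  bit : ℕ → ℕ
  bit i = i / 2 ^ e % 2

  bit-< : ∀ {i} → i < 2 ^ e → bit i ≡ 0
  bit-< i<2^e = cong (_% 2) (m<n⇒m/n≡0 i<2^e)

  bit-2^+ : ∀ {i} → i < 2 ^ e → bit (2 ^ e + i) ≡ 1
  bit-2^+ {i} i<2^e = cong (_% 2) (begin
    (2 ^ e + i) / 2 ^ e      ≡⟨ cong (λ x → (x + i) / 2 ^ e) (sym (*-identityˡ (2 ^ e))) ⟩
    (1 * 2 ^ e + i) / 2 ^ e  ≡⟨ [m*n+o]/n≡m+o/n 1 (2 ^ e) i ⟩
    1 + i / 2 ^ e            ≡⟨ cong (1 +_) (m<n⇒m/n≡0 i<2^e) ⟩
    1                        ∎)
    where open ≡-Reasoning

  bit-2^+-< : ∀ {k} i → e < k → bit (2 ^ k + i) ≡ bit i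
  bit-2^+-< {k} i e<k = begin
    (2 ^ k + i) / 2 ^ e % 2              ≡⟨ cong (λ x → (x + i) / 2 ^ e % 2) 2^k≡2^[1+d]*2^e ⟩
    (2 ^ suc d * 2 ^ e + i) / 2 ^ e % 2  ≡⟨ cong (_% 2) ([m*n+o]/n≡m+o/n (2 ^ suc d) (2 ^ e) i) ⟩
    (2 * 2 ^ d + i / 2 ^ e) % 2          ≡⟨ %-remove-+ˡ (i / 2 ^ e) (m∣m*n (2 ^ d)) ⟩
    i / 2 ^ e % 2                        ∎
    where
    open ≡-Reasoning
    d : ℕ
    d = k ∸ suc e
    2^k≡2^[1+d]*2^e : 2 ^ k ≡ 2 ^ suc d * 2 ^ e
    2^k≡2^[1+d]*2^e = trans (cong (2 ^_) (sym (trans (sym (+-suc d e)) (m∸n+n≡m e<k))))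
                            (^-distribˡ-+-* 2 (suc d) e)

<ᵇ-true : ∀ {m n} → m < n → (m <ᵇ n) ≡ true
<ᵇ-true = dec-true (_ <? _)

<ᵇ-false : ∀ {m n} → n ≤ m → (m <ᵇ n) ≡ false
<ᵇ-false n≤m = dec-false (_ <? _) (≤⇒≯ n≤m)

digit : ℕ → ℕ → ℕ → Sym
digit k i c = bitSym (bit (k ∸ suc c) i)

leadingDigit-< : ∀ k {i} → i < 2 ^ k → digit (suc k) i 0 ≡ s0
leadingDigit-< k i<2^k = cong bitSym (bit-< k i<2^k)

leadingDigit-2^+ : ∀ k {i} → i < 2 ^ k → digit (suc k) (2 ^ k + i) 0 ≡ s1
leadingDigit-2^+ k i<2^k = cong bitSym (bit-2^+ k i<2^k)

digit-dropLeading : ∀ k i c → digit (suc (suc k)) (2 ^ suc k + i) (suc c) ≡ digit (suc k) i c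
digit-dropLeading k i c = cong bitSym (bit-2^+-< (k ∸ c) i (s≤s (m∸n≤m k c)))

binAt-digit : ∀ {n i c} → c < n → binAt n i (suc c) ≡ digit n i c
binAt-digit {n} {i} {c} c<n = cong (if_then dollar else digit n i c) (dec-false (c ≟ n) (<⇒≢ c<n))

binAt-last : ∀ n i → binAt n i (suc n + 0) ≡ dollar
binAt-last n i = cong (if_then dollar else digit n i (n + 0)) (dec-true (n + 0 ≟ n) (+-identityʳ n))

shiftedBinAt : ℕ → ℕ → ℕ → ℕ → Sym
shiftedBinAt n i b c = if not (i <ᵇ b) ∧ (i <ᵇ b + 2 ^ n) then binAt n (i ∸ b) c else s0

shiftedBinAt-translate : ∀ n q i b c → shiftedBinAt n (q + i) (q + b) c ≡ shiftedBinAt n i b c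
shiftedBinAt-translate n zero    i b c = refl
shiftedBinAt-translate n (suc q) i b c = shiftedBinAt-translate n q i b c

shiftedBinAt-above : ∀ n {i b} c → i < b → shiftedBinAt n i b c ≡ s0
shiftedBinAt-above n {i} {b} c i<b =
  cong (λ x → if not x ∧ (i <ᵇ b + 2 ^ n) then binAt n (i ∸ b) c else s0) (<ᵇ-true i<b)

shiftedBinAt-below : ∀ n {i b} c → b + 2 ^ n ≤ i → shiftedBinAt n i b c ≡ s0
shiftedBinAt-below n {i} {b} c b+2^n≤i =
  cong₂ (λ x y → if not x ∧ y then binAt n (i ∸ b) c else s0)
        (<ᵇ-false (≤-trans (m≤m+n b (2 ^ n)) b+2^n≤i)) (<ᵇ-false b+2^n≤i)

shiftedBinAt-unshifted : ∀ n {i} c → i < 2 ^ n → shiftedBinAt n i 0 c ≡ binAt n i c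
shiftedBinAt-unshifted n {i} c i<2^n = cong (if_then binAt n i c else s0) (<ᵇ-true i<2^n)

module _ {n : ℕ} where
  private
    W : ℕ
    W = 2 + n

  shiftBinAt-block : ∀ q i c → shiftBinAt n i (q * (n + 2) + c) ≡ shiftedBinAt n i (q + c / W) (c % W)
  shiftBinAt-block q i c = begin
    shiftBinAt n i (q * (n + 2) + c)            ≡⟨ cong (λ w → shiftBinAt n i (q * w + c)) (+-comm n 2) ⟩
    shiftedBinAt n i ((q * W + c) / W) ((q * W + c) % W)
                                                ≡⟨ cong₂ (shiftedBinAt n i) ([m*n+o]/n≡m+o/n q W c) ([m*n+o]%n≡o%n q W c) ⟩
    shiftedBinAt n i (q + c / W) (c % W)        ∎
    where open ≡-Reasoning

  shiftBinAt-translate : ∀ q i c → shiftBinAt n (q + i) (q * (n + 2) + c) ≡ shiftBinAt n i c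
  shiftBinAt-translate q i c = trans (shiftBinAt-block q (q + i) c) (shiftedBinAt-translate n q i (c / W) (c % W))

  shiftBinAt-above-copies : ∀ {q i} c → i < q → shiftBinAt n i (q * (n + 2) + c) ≡ s0
  shiftBinAt-above-copies {q} {i} c i<q =
    trans (shiftBinAt-block q i c) (shiftedBinAt-above n (c % W) (≤-trans i<q (m≤m+n q (c / W))))

  shiftBinAt-below-copies : ∀ {q i c} → c < q * (n + 2) → q + 2 ^ n ≤ suc i → shiftBinAt n i c ≡ s0
  shiftBinAt-below-copies {q} {i} {c} c<q*W q+2^n≤1+i = shiftedBinAt-below n (c % W) (≤-pred (begin-strict
    c / W + 2 ^ n  <⟨ +-monoˡ-< (2 ^ n) (m<n*o⇒m/o<n (subst (λ w → c < q * w) (+-comm n 2) c<q*W)) ⟩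
    q + 2 ^ n      ≤⟨ q+2^n≤1+i ⟩
    suc i          ∎))
    where open ≤-Reasoning

  shiftBinAt-first-copy : ∀ {i c} → i < 2 ^ n → c < n + 2 → shiftBinAt n i c ≡ binAt n i c
  shiftBinAt-first-copy {i} {c} i<2^n c<n+2 =
    trans (cong₂ (shiftedBinAt n i) (m<n⇒m/n≡0 c<W) (m<n⇒m%n≡m c<W)) (shiftedBinAt-unshifted n c i<2^n)
    where
    c<W : c < W
    c<W = subst (c <_) (+-comm n 2) c<n+2

Plane : Set
Plane = ℕ → ℕ → Sym

Agrees : ∀ {h w} → Grid h w → Plane → Set
Agrees A s = ∀ i j → A i j ≡ s (toℕ i) (toℕ j)

hcat-agrees : ∀ {h w₁ w₂} {A : Grid h w₁} {B : Grid h w₂} {s : Plane} →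
              Agrees A s → Agrees B (λ i j → s i (w₁ + j)) → Agrees (hcat A B) s
hcat-agrees {w₁ = w₁} {w₂} {s = s} A≈s B≈s i j with splitAt w₁ j in eq
... | inj₁ k = trans (A≈s i k) (cong (s (toℕ i)) (trans (sym (toℕ-↑ˡ k w₂)) (cong toℕ (splitAt⁻¹-↑ˡ eq))))
... | inj₂ k = trans (B≈s i k) (cong (s (toℕ i)) (trans (sym (toℕ-↑ʳ w₁ k)) (cong toℕ (splitAt⁻¹-↑ʳ eq))))

vcat-agrees : ∀ {h₁ h₂ w} {A : Grid h₁ w} {B : Grid h₂ w} {s : Plane} →
              Agrees A s → Agrees B (λ i j → s (h₁ + i) j) → Agrees (vcat A B) s
vcat-agrees {h₁} {h₂} {s = s} A≈s B≈s i j with splitAt h₁ i in eq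
... | inj₁ k = trans (A≈s k j) (cong (λ x → s x (toℕ j)) (trans (sym (toℕ-↑ˡ k h₂)) (cong toℕ (splitAt⁻¹-↑ˡ eq))))
... | inj₂ k = trans (B≈s k j) (cong (λ x → s x (toℕ j)) (trans (sym (toℕ-↑ʳ h₁ k)) (cong toℕ (splitAt⁻¹-↑ʳ eq))))

data Production (N : Set) : Set where
  char         : Sym → Production N
  beside above : N → N → Production N

Children : ∀ {N} → (N → Set) → Production N → Set
Children P (char _)     = ⊤
Children P (beside b c) = P b × P c
Children P (above b c)  = P b × P c

Children-map : ∀ {N} {P Q : N → Set} → (∀ {b} → P b → Q b) → ∀ π → Children P π → Children Q π
Children-map f (char _)     _         = tt
Children-map f (beside b c) (pb , pc) = f pb , f pc
Children-map f (above b c)  (pb , pc) = f pb , f pc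

module Derivations {N : Set} (production : N → Production N) where

  data Derivation : N → (h w : ℕ) → Grid h w → Set where
    derive-char   : ∀ {a c} → production a ≡ char c → Derivation a 1 1 (λ _ _ → c)
    derive-beside : ∀ {a b c h w₁ w₂ A B} → production a ≡ beside b c →
                    Derivation b h w₁ A → Derivation c h w₂ B → Derivation a h (w₁ + w₂) (hcat A B)
    derive-above  : ∀ {a b c h₁ h₂ w A B} → production a ≡ above b c →
                    Derivation b h₁ w A → Derivation c h₂ w B → Derivation a (h₁ + h₂) w (vcat A B)

  record Generates (a : N) (h w : ℕ) (s : Plane) : Set where
    constructor generates
    field
      {grid}     : Grid h w
      derivation : Derivation a h w grid
      agrees     : Agrees grid s

  generates-char : ∀ {a c} → production a ≡ char c → Generates a 1 1 (λ _ _ → c)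
  generates-char e = generates (derive-char e) (λ _ _ → refl)

  generates-beside : ∀ {a b c h w₁ w₂ s} → production a ≡ beside b c →
                     Generates b h w₁ s → Generates c h w₂ (λ i j → s i (w₁ + j)) → Generates a h (w₁ + w₂) s
  generates-beside {s = s} e (generates d₁ ag₁) (generates d₂ ag₂) = generates (derive-beside e d₁ d₂) (hcat-agrees {s = s} ag₁ ag₂)

  generates-above : ∀ {a b c h₁ h₂ w s} → production a ≡ above b c →
                    Generates b h₁ w s → Generates c h₂ w (λ i j → s (h₁ + i) j) → Generates a (h₁ + h₂) w s
  generates-above {s = s} e (generates d₁ ag₁) (generates d₂ ag₂) = generates (derive-above e d₁ d₂) (vcat-agrees {s = s} ag₁ ag₂)

  generates-cong : ∀ {a h w s s′} → (∀ i j → i < h → j < w → s i j ≡ s′ i j) → Generates a h w s → Generates a h w s′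
  generates-cong s≈s′ (generates d ag) = generates d (λ i j → trans (ag i j) (s≈s′ _ _ (toℕ<n i) (toℕ<n j)))

  generates-column-cong : ∀ {a h s s′} → (∀ i → i < h → s i 0 ≡ s′ i 0) → Generates a h 1 s → Generates a h 1 s′
  generates-column-cong s≈s′ = generates-cong λ where
    i zero    i<h _        → s≈s′ i i<h
    i (suc j) _   (s≤s ())

  generates-resize : ∀ {a h h′ w w′ s} → h ≡ h′ → w ≡ w′ → Generates a h w s → Generates a h′ w′ s
  generates-resize refl refl g = g

  module Truncation (rank : N → ℕ) (decode : ℕ → N) (decode-rank : ∀ a → decode (rank a) ≡ a)
                    (rank-decreasing : ∀ a → Children (λ b → rank b < rank a) (production a)) where

    below : ∀ {m y} (X : Fin m) → y < toℕ X → Fin m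
    below X y<X = fromℕ< (<-trans y<X (toℕ<n X))

    below-< : ∀ {m y} (X : Fin m) (y<X : y < toℕ X) → toℕ (below X y<X) < toℕ X
    below-< X y<X = subst (_< toℕ X) (sym (toℕ-fromℕ< _)) y<X

    -- The junk fallback is never reached from a derivation, as ranks decrease along productions;
    -- it only makes every rule of Fin m acyclic.
    binaryRule : ∀ {m} → (Fin m → Fin m → Rule m) → Fin m → N → N → Rule m
    binaryRule op X b c with rank b <? toℕ X | rank c <? toℕ X
    ... | yes b<X | yes c<X = op (below X b<X) (below X c<X)
    ... | _       | _       = chr s0

    binaryRule-below : ∀ {m} op (X : Fin m) {b c} (b<X : rank b < toℕ X) (c<X : rank c < toℕ X) →
                       binaryRule op X b c ≡ op (below X b<X) (below X c<X)
    binaryRule-below op X {b} {c} b<X c<X with rank b <? toℕ X | rank c <? toℕ X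
    ... | yes p | yes q = cong₂ op (cong (below X) (<-irrelevant p b<X)) (cong (below X) (<-irrelevant q c<X))
    ... | no ¬p | _     = contradiction b<X ¬p
    ... | yes _ | no ¬q = contradiction c<X ¬q

    toRule : ∀ {m} → Fin m → Production N → Rule m
    toRule X (char c)     = chr c
    toRule X (beside b c) = binaryRule hor X b c
    toRule X (above b c)  = binaryRule ver X b c

    toRule-acyclic : ∀ {m} (X : Fin m) π → RefsBelow X (toRule X π)
    toRule-acyclic X (char _) = tt
    toRule-acyclic X (beside b c) with rank b <? toℕ X | rank c <? toℕ X
    ... | yes b<X | yes c<X = below-< X b<X , below-< X c<X
    ... | yes _   | no _    = tt
    ... | no _    | _       = tt
    toRule-acyclic X (above b c) with rank b <? toℕ X | rank c <? toℕ X
    ... | yes b<X | yes c<X = below-< X b<X , below-< X c<X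
    ... | yes _   | no _    = tt
    ... | no _    | _       = tt

    slp : ∀ {m} → Fin m → SLP2 m
    slp start = record
      { rule    = λ X → toRule X (production (decode (toℕ X)))
      ; acyclic = λ X → toRule-acyclic X (production (decode (toℕ X)))
      ; start   = start
      }

    module _ {m} (start : Fin m) where

      rule-rank : ∀ {a} (X : Fin m) → toℕ X ≡ rank a → SLP2.rule (slp start) X ≡ toRule X (production a)
      rule-rank {a} X X≡a = cong (toRule X ∘ production) (trans (cong decode X≡a) (decode-rank a))

      children-below : ∀ {a π} (X : Fin m) → toℕ X ≡ rank a → production a ≡ π → Children (λ b → rank b < toℕ X) π
      children-below {a} X X≡a refl = Children-map (subst (_ <_) (sym X≡a)) (production a) (rank-decreasing a)

      derives : ∀ {a h w A} (X : Fin m) → toℕ X ≡ rank a → Derivation a h w A → Derives (slp start) X h w A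
      derives X X≡a (derive-char e) = dchr (trans (rule-rank X X≡a) (cong (toRule X) e))
      derives X X≡a (derive-beside e d₁ d₂) with b<X , c<X ← children-below X X≡a e =
        dhor (trans (rule-rank X X≡a) (trans (cong (toRule X) e) (binaryRule-below hor X b<X c<X)))
             (derives (below X b<X) (toℕ-fromℕ< _) d₁) (derives (below X c<X) (toℕ-fromℕ< _) d₂)
      derives X X≡a (derive-above e d₁ d₂) with b<X , c<X ← children-below X X≡a e =
        dver (trans (rule-rank X X≡a) (trans (cong (toRule X) e) (binaryRule-below ver X b<X c<X)))
             (derives (below X b<X) (toℕ-fromℕ< _) d₁) (derives (below X c<X) (toℕ-fromℕ< _) d₂)

    derivesGrid : ∀ {m a h w s} (a<m : rank a < m) → Generates a h w s →
                  DerivesGrid (slp (fromℕ< a<m)) h w (λ i j → s (toℕ i) (toℕ j))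
    derivesGrid a<m (generates d ag) = _ , derives (fromℕ< a<m) (fromℕ< a<m) (toℕ-fromℕ< a<m) d , ag

data Name : Set where
  column                                   : Sym → ℕ → Name
  zeroRow counter counterTop counterBottom : ℕ → Name
  dollarCounter binary                     : ℕ → Name
  zeroPair zeroBlock                       : ℕ → Name
  shiftLeft shiftRight shift               : ℕ → Name

module ShiftBinGrammar (n′ : ℕ) where

  n : ℕ
  n = suc n′

  zeros : ℕ → Name
  zeros zero    = zeroRow (suc n)
  zeros (suc j) = zeroBlock j

  production : Name → Production Name
  production (column a zero)    = char a
  production (column a (suc k)) = above (column a k) (column a k)
  production (zeroRow zero)     = char s0
  production (zeroRow (suc k))  = beside (zeroRow k) (column s0 0)
  production (counter zero)     = above (column s0 0) (column s1 0)
  production (counter (suc k))  = above (counterTop k) (counterBottom k)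
  production (counterTop k)     = beside (column s0 (suc k)) (counter k)
  production (counterBottom k)  = beside (column s1 (suc k)) (counter k)
  production (dollarCounter k)  = beside (column dollar (suc k)) (counter k)
  production (binary k)         = beside (dollarCounter k) (column dollar (suc k))
  production (zeroPair j)       = beside (zeros j) (zeros j)
  production (zeroBlock j)      = above (zeroPair j) (zeroPair j)
  production (shiftLeft j)      = above (shift j) (zeros j)
  production (shiftRight j)     = above (zeros j) (shift j)
  production (shift zero)       = above (binary n′) (zeros 0)
  production (shift (suc j))    = beside (shiftLeft j) (shiftRight j)

  -- Nonterminals are numbered level-major, 14 slots per level; every production refers to a lower
  -- level or to an earlier slot of the same level (production-≺).
  level : Name → ℕ
  level (column _ k)      = k
  level (zeroRow k)       = k
  level (counter k)       = suc k
  level (counterTop k)    = suc (suc k)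
  level (counterBottom k) = suc (suc k)
  level (dollarCounter k) = suc k
  level (binary k)        = suc k
  level (zeroPair j)      = suc n + suc j
  level (zeroBlock j)     = suc n + suc j
  level (shiftLeft j)     = suc n + suc j
  level (shiftRight j)    = suc n + suc j
  level (shift j)         = suc n + j

  slot : Name → Fin 14
  slot (column s0 _)     = # 0
  slot (column s1 _)     = # 1
  slot (column dollar _) = # 2
  slot (zeroRow _)       = # 3
  slot (counterTop _)    = # 4
  slot (counterBottom _) = # 5
  slot (counter _)       = # 6
  slot (dollarCounter _) = # 7
  slot (binary _)        = # 8
  slot (zeroPair _)      = # 9
  slot (zeroBlock _)     = # 10
  slot (shiftLeft _)     = # 11
  slot (shiftRight _)    = # 12
  slot (shift _)         = # 13

  rank : Name → ℕ
  rank a = level a * 14 + toℕ (slot a)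

  fromLevelSlot : ℕ → ℕ → Name
  fromLevelSlot L 0  = column s0 L
  fromLevelSlot L 1  = column s1 L
  fromLevelSlot L 2  = column dollar L
  fromLevelSlot L 3  = zeroRow L
  fromLevelSlot L 4  = counterTop (L ∸ 2)
  fromLevelSlot L 5  = counterBottom (L ∸ 2)
  fromLevelSlot L 6  = counter (pred L)
  fromLevelSlot L 7  = dollarCounter (pred L)
  fromLevelSlot L 8  = binary (pred L)
  fromLevelSlot L 9  = zeroPair (pred (L ∸ suc n))
  fromLevelSlot L 10 = zeroBlock (pred (L ∸ suc n))
  fromLevelSlot L 11 = shiftLeft (pred (L ∸ suc n))
  fromLevelSlot L 12 = shiftRight (pred (L ∸ suc n))
  fromLevelSlot L _  = shift (L ∸ suc n)

  fromLevelSlot-level-slot : ∀ a → fromLevelSlot (level a) (toℕ (slot a)) ≡ a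
  fromLevelSlot-level-slot (column s0 k)     = refl
  fromLevelSlot-level-slot (column s1 k)     = refl
  fromLevelSlot-level-slot (column dollar k) = refl
  fromLevelSlot-level-slot (zeroRow k)       = refl
  fromLevelSlot-level-slot (counter k)       = refl
  fromLevelSlot-level-slot (counterTop k)    = refl
  fromLevelSlot-level-slot (counterBottom k) = refl
  fromLevelSlot-level-slot (dollarCounter k) = refl
  fromLevelSlot-level-slot (binary k)        = refl
  fromLevelSlot-level-slot (zeroPair j)      = cong (zeroPair ∘ pred) (m+n∸m≡n (suc n) (suc j))
  fromLevelSlot-level-slot (zeroBlock j)     = cong (zeroBlock ∘ pred) (m+n∸m≡n (suc n) (suc j))
  fromLevelSlot-level-slot (shiftLeft j)     = cong (shiftLeft ∘ pred) (m+n∸m≡n (suc n) (suc j))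
  fromLevelSlot-level-slot (shiftRight j)    = cong (shiftRight ∘ pred) (m+n∸m≡n (suc n) (suc j))
  fromLevelSlot-level-slot (shift j)         = cong shift (m+n∸m≡n (suc n) j)

  decode : ℕ → Name
  decode x = fromLevelSlot (x / 14) (x % 14)

  decode-rank : ∀ a → decode (rank a) ≡ a
  decode-rank a = trans (cong₂ fromLevelSlot ([m*c+i]/c≡m (level a) (slot a)) ([m*c+i]%c≡i (level a) (slot a)))
                        (fromLevelSlot-level-slot a)

  data _≺_ (b a : Name) : Set where
    lower-level : level b < level a → b ≺ a
    same-level  : level b ≡ level a → T (toℕ (slot b) <ᵇ toℕ (slot a)) → b ≺ a

  ≺⇒rank< : ∀ {b a} → b ≺ a → rank b < rank a
  ≺⇒rank< {b} {a} (lower-level lb<la) = [m*c+i]<[n*c+j] (slot b) (slot a) lb<la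
  ≺⇒rank< {b} {a} (same-level lb≡la sb<sa) =
    subst (λ L → L * 14 + toℕ (slot b) < rank a) (sym lb≡la) (+-monoʳ-< (level a * 14) (<ᵇ⇒< _ _ sb<sa))

  zeros-level : ∀ j → level (zeros j) < suc n + suc j
  zeros-level zero    = m<m+n (suc n) z<s
  zeros-level (suc j) = +-monoʳ-< (suc n) (n<1+n (suc j))

  shift-level : ∀ j → level (shift j) < suc n + suc j
  shift-level j = +-monoʳ-< (suc n) (n<1+n j)

  production-≺ : ∀ a → Children (_≺ a) (production a)
  production-≺ (column a zero)    = tt
  production-≺ (column a (suc k)) = lower-level (n<1+n k) , lower-level (n<1+n k)
  production-≺ (zeroRow zero)     = tt
  production-≺ (zeroRow (suc k))  = lower-level (n<1+n k) , lower-level z<s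
  production-≺ (counter zero)     = lower-level z<s , lower-level z<s
  production-≺ (counter (suc k))  = same-level refl tt , same-level refl tt
  production-≺ (counterTop k)     = lower-level (n<1+n (suc k)) , lower-level (n<1+n (suc k))
  production-≺ (counterBottom k)  = lower-level (n<1+n (suc k)) , lower-level (n<1+n (suc k))
  production-≺ (dollarCounter k)  = same-level refl tt , same-level refl tt
  production-≺ (binary k)         = same-level refl tt , same-level refl tt
  production-≺ (zeroPair j)       = lower-level (zeros-level j) , lower-level (zeros-level j)
  production-≺ (zeroBlock j)      = same-level refl tt , same-level refl tt
  production-≺ (shiftLeft j)      = lower-level (shift-level j) , lower-level (zeros-level j)
  production-≺ (shiftRight j)     = lower-level (zeros-level j) , lower-level (shift-level j)
  production-≺ (shift zero)       = lower-level (m≤m+n (suc n) 0) , same-level (sym (+-identityʳ (suc n))) tt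
  production-≺ (shift (suc j))    = same-level refl tt , same-level refl tt

  open Derivations production
  open Truncation rank decode decode-rank (λ a → Children-map ≺⇒rank< (production a) (production-≺ a))

  column-generates : ∀ a k → Generates (column a k) (2 ^ k) 1 (λ _ _ → a)
  column-generates a zero    = generates-char refl
  column-generates a (suc k) = generates-resize (m+m≡2*m (2 ^ k)) refl
    (generates-above refl (column-generates a k) (column-generates a k))

  zeroRow-generates : ∀ k → Generates (zeroRow k) 1 (suc k) (λ _ _ → s0)
  zeroRow-generates zero    = generates-char refl
  zeroRow-generates (suc k) = generates-resize refl (+-comm (suc k) 1)
    (generates-beside refl (zeroRow-generates k) (column-generates s0 0))

  counter-generates : ∀ k → Generates (counter k) (2 ^ suc k) (suc k) (digit (suc k))
  counter-generates zero = generates-above refl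
    (generates-column-cong (λ _ i<1 → sym (leadingDigit-< 0 i<1)) (column-generates s0 0))
    (generates-column-cong (λ _ i<1 → sym (leadingDigit-2^+ 0 i<1)) (column-generates s1 0))
  counter-generates (suc k) = generates-resize (m+m≡2*m (2 ^ suc k)) refl
    (generates-above refl top bottom)
    where
    top : Generates (counterTop k) (2 ^ suc k) (suc (suc k)) (digit (suc (suc k)))
    top = generates-beside refl
      (generates-column-cong (λ _ i< → sym (leadingDigit-< (suc k) i<)) (column-generates s0 (suc k)))
      (counter-generates k)
    bottom : Generates (counterBottom k) (2 ^ suc k) (suc (suc k)) (λ i → digit (suc (suc k)) (2 ^ suc k + i))
    bottom = generates-beside refl
      (generates-column-cong (λ _ i< → sym (leadingDigit-2^+ (suc k) i<)) (column-generates s1 (suc k)))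
      (generates-cong (λ i c _ _ → sym (digit-dropLeading k i c)) (counter-generates k))

  binary-generates : ∀ k → Generates (binary k) (2 ^ suc k) (suc k + 2) (binAt (suc k))
  binary-generates k = generates-resize refl (sym (+-suc (suc k) 1))
    (generates-beside refl left
      (generates-column-cong (λ i _ → sym (binAt-last (suc k) i)) (column-generates dollar (suc k))))
    where
    left : Generates (dollarCounter k) (2 ^ suc k) (suc (suc k)) (binAt (suc k))
    left = generates-beside refl
      (generates-column-cong (λ _ _ → refl) (column-generates dollar (suc k)))
      (generates-cong (λ _ _ _ c<1+k → sym (binAt-digit c<1+k)) (counter-generates k))

  width-double : ∀ j → 2 ^ j * (n + 2) + 2 ^ j * (n + 2) ≡ 2 ^ suc j * (n + 2)
  width-double j = trans (sym (*-distribʳ-+ (n + 2) (2 ^ j) (2 ^ j))) (cong (_* (n + 2)) (m+m≡2*m (2 ^ j)))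

  zeros-generates : ∀ j → Generates (zeros j) (2 ^ j) (2 ^ j * (n + 2)) (λ _ _ → s0)
  zeros-generates zero    = generates-resize refl (sym (trans (*-identityˡ (n + 2)) (+-comm n 2)))
    (zeroRow-generates (suc n))
  zeros-generates (suc j) = generates-resize (m+m≡2*m (2 ^ j)) (width-double j)
    (generates-above refl pair pair)
    where
    pair : Generates (zeroPair j) (2 ^ j) (2 ^ j * (n + 2) + 2 ^ j * (n + 2)) (λ _ _ → s0)
    pair = generates-beside refl (zeros-generates j) (zeros-generates j)

  shift-generates : ∀ j → Generates (shift j) (2 ^ n + 2 ^ j) (2 ^ j * (n + 2)) (shiftBinAt n)
  shift-generates zero = generates-above refl
    (generates-resize refl (sym (*-identityˡ (n + 2)))
      (generates-cong (λ _ _ i<2^n c<n+2 → sym (shiftBinAt-first-copy i<2^n c<n+2)) (binary-generates n′)))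
    (generates-cong (λ i _ _ c<n+2 → sym (shiftBinAt-below-copies {q = 1} c<n+2 (s≤s (m≤m+n (2 ^ n) i))))
      (zeros-generates 0))
  shift-generates (suc j) = generates-resize refl (width-double j) (generates-beside refl left right)
    where
    height : 2 ^ n + 2 ^ j + 2 ^ j ≡ 2 ^ n + 2 ^ suc j
    height = trans (+-assoc (2 ^ n) (2 ^ j) (2 ^ j)) (cong (2 ^ n +_) (m+m≡2*m (2 ^ j)))
    left : Generates (shiftLeft j) (2 ^ n + 2 ^ suc j) (2 ^ j * (n + 2)) (shiftBinAt n)
    left = generates-resize height refl (generates-above refl (shift-generates j)
      (generates-cong (λ i _ _ c< → sym (shiftBinAt-below-copies {q = 2 ^ j} c<
                         (≤-trans (≤-reflexive (+-comm (2 ^ j) (2 ^ n))) (≤-trans (m≤m+n _ i) (n≤1+n _)))))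
        (zeros-generates j)))
    right : Generates (shiftRight j) (2 ^ n + 2 ^ suc j) (2 ^ j * (n + 2)) (λ i c → shiftBinAt n i (2 ^ j * (n + 2) + c))
    right = generates-resize (trans (+-comm (2 ^ j) _) height) refl (generates-above refl
      (generates-cong (λ _ c i<2^j _ → sym (shiftBinAt-above-copies c i<2^j)) (zeros-generates j))
      (generates-cong (λ i c _ _ → sym (shiftBinAt-translate (2 ^ j) i c)) (shift-generates j)))

  size : ℕ
  size = suc (level (shift n)) * 14

  shift-n<size : rank (shift n) < size
  shift-n<size = [m*c+i]<[1+m]*c (level (shift n)) (slot (shift n))

  grammar : SLP2 size
  grammar = slp (fromℕ< shift-n<size)

  grammar-derives-ShiftBin : DerivesGrid grammar (2 * 2 ^ n) (2 ^ n * (n + 2)) (ShiftBin n)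
  grammar-derives-ShiftBin = derivesGrid shift-n<size (generates-resize (m+m≡2*m (2 ^ n)) refl (shift-generates n))

  size≤56n : size ≤ 56 * n
  size≤56n = begin
    size          ≡⟨ solve 1 (λ k → (con 3 :+ k :+ (con 1 :+ k)) :* con 14 := con 56 :+ k :* con 28) refl n′ ⟩
    56 + n′ * 28  ≤⟨ +-monoʳ-≤ 56 (*-monoʳ-≤ n′ (m≤m+n 28 28)) ⟩
    56 + n′ * 56  ≡⟨ solve 1 (λ k → con 56 :+ k :* con 56 := con 56 :* (con 1 :+ k)) refl n′ ⟩
    56 * n        ∎
    where open ≤-Reasoning

lemma4p3 : Σ ℕ λ C → 0 < C × ((n : ℕ) → 1 ≤ n →
    Σ ℕ λ m → m ≤ C * n × Σ (SLP2 m) λ G →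
    DerivesGrid G (2 * 2 ^ n) (2 ^ n * (n + 2)) (ShiftBin n))
lemma4p3 = 56 , z<s , λ where
  (suc n′) _ → let open ShiftBinGrammar n′ in size , size≤56n , grammar , grammar-derives-ShiftBin
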